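{- Let $n\ge1$. For every $u\in[\mathbf{n}]^*$, the formal power series $Z(u)=\sum_{w\ge u}w$ and $M(u)=\sum_{w\ge u}\big(\sum_{\eta_u}(-1)^{d(\eta_u)}\big)w$ in $\mathbb{Z}\langle\langle[\mathbf{n}]\rangle\rangle$ are rational.
   Context: Composition order: for words $u,w$ over the positive integers, $u\le w$ iff there are indices $i_1<\cdots<i_l$ with $l=\ell(u)$ and $u(j)\le w(i_j)$ for all $j$. $[\mathbf{n}]^*$ is the poset of words over the letters $\mathbf{1},\ldots,\mathbf{n}$ with this order; sums over $w$ are over $w\in[\mathbf{n}]^*$. $\mathbb{Z}\langle\langle[\mathbf{n}]\rangle\rangle$ is the algebra of formal power series in the noncommuting variables $\mathbf{1},\ldots,\mathbf{n}$ with integer coefficients; $\varepsilon$ is the empty word. A series is rational if it can be constructed from a finite set of monomials using finitely many algebra operations and applications of the star operation $f\mapsto f^*=\varepsilon+f+f^2+\cdots$ (applied to series $f$ with zero constant term). An expansion of $u$ is a word $\eta$ over $\mathbb{P}\cup\{0\}$ whose restriction to its support $\{i:\eta(i)\neq0\}$ is $u$; an embedding of $u$ into $w$ is an expansion $\eta_u$ of length $\ell(w)$ with $\eta_u(i)\le w(i)$ for all $i$. A run of $\mathbf{k}$'s in $w$ is a maximal index interval $[r,t]$ with $w(r)=\cdots=w(t)=\mathbf{k}$. An embedding is normal if (1) $\eta_u(i)\in\{w(i),w(i)-1,0\}$ for all $i$, and (2) for every run $[r,t]$ of $\mathbf{k}$'s in $w$: $(r,t]\subseteq\operatorname{Supp}\eta_u$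 if $k=1$, and $r\in\operatorname{Supp}\eta_u$ if $k\ge2$. The defect is $d(\eta_u)=\#\{i:\eta_u(i)=w(i)-1\}$; the inner sum in $M(u)$ is over all normal embeddings of $u$ into $w$. -}

module Defs where

open import Data.Nat as ℕ using (ℕ; zero; suc; _∸_)
open import Data.Fin as Fin using (Fin; toℕ)
open import Data.Integer as ℤ using (ℤ; +_; -_; _+_; _*_)
open import Data.List using (List; []; _∷_; map; filter; concatMap; length; foldr)
open import Data.List.Properties using (≡-dec)
open import Data.Bool using (Bool; true; false; _∧_; _∨_; not; if_then_else_)
open import Data.Maybe using (Maybe; just; nothing)
open import Data.Product using (_×_; _,_; proj₁; proj₂)
open import Relation.Binary.PropositionalEquality using (_≡_; refl)
open import Relation.Nullary using (Dec; yes; no; ¬_)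
open import Relation.Nullary.Decidable using (⌊_⌋)

-- Words over [n] : the letter 𝐤 (1 ≤ k ≤ n) is represented by
-- (i : Fin n) with toℕ i ≡ k - 1.  Its numeric value is suc (toℕ i).

Word : ℕ → Set
Word n = List (Fin n)

letterVal : ∀ {n} → Fin n → ℕ
letterVal i = suc (toℕ i)

wordVals : ∀ {n} → Word n → List ℕ
wordVals = map letterVal

infix 4 _≼_
data _≼_ {n : ℕ} : Word n → Word n → Set where
  nil  : ∀ {w} → [] ≼ w
  skip : ∀ {u w b} → u ≼ w → u ≼ (b ∷ w)
  keep : ∀ {u w a b} → a Fin.≤ b → u ≼ w → (a ∷ u) ≼ (b ∷ w)

private
  ≼-nil-inv : ∀ {n} {a : Fin n} {u} → ¬ ((a ∷ u) ≼ [])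
  ≼-nil-inv ()

_≼?_ : ∀ {n} (u w : Word n) → Dec (u ≼ w)
[] ≼? w = yes nil
(a ∷ u) ≼? [] = no ≼-nil-inv
(a ∷ u) ≼? (b ∷ w) with a Fin.≤? b | u ≼? w | (a ∷ u) ≼? w
... | yes a≤b | yes u≼w | _ = yes (keep a≤b u≼w)
... | _ | _ | yes p = yes (skip p)
... | no a≰b | _ | no q = no λ { (skip p) → q p ; (keep a≤b _) → a≰b a≤b }
... | yes _ | no u⋠w | no q = no λ { (skip p) → q p ; (keep _ r) → u⋠w r }

sumℤ : List ℤ → ℤ
sumℤ = foldr _+_ (+ 0)

Series : ℕ → Set
Series n = Word n → ℤ

monomial : ∀ {n} → Word n → Series n
monomial v w = if ⌊ ≡-dec Fin._≟_ v w ⌋ then + 1 else + 0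

_⊕_ : ∀ {n} → Series n → Series n → Series n
(f ⊕ g) w = f w + g w

⊖_ : ∀ {n} → Series n → Series n
(⊖ f) w = - f w

splits : ∀ {A : Set} → List A → List (List A × List A)
splits [] = ([] , []) ∷ []
splits (a ∷ w) = ([] , a ∷ w) ∷ map (λ p → (a ∷ proj₁ p , proj₂ p)) (splits w)

_⊛_ : ∀ {n} → Series n → Series n → Series n
(f ⊛ g) w = sumℤ (map (λ p → f (proj₁ p) * g (proj₂ p)) (splits w))

pow : ∀ {n} → Series n → ℕ → Series n
pow f zero = monomial []
pow f (suc k) = f ⊛ pow f k

-- For f with zero constant term, f^k has no
-- words of length < k, so the coefficient of w in f* is the finite sum
-- Σ_{k=0}^{ℓ(w)} (f^k)(w).  (Only applied below to f with f(ε) = 0.)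
star : ∀ {n} → Series n → Series n
star f w = go (length w)
  where
  go : ℕ → ℤ
  go zero = pow f zero w
  go (suc k) = pow f (suc k) w + go k

-- Rational series: the smallest class containing the monomials, closed
-- under the algebra operations (sum, negation, product; integer scalars
-- and 0 are obtained from these) and under star applied to series with
-- zero constant term; series are identified extensionally.
data IsRational {n : ℕ} : Series n → Set where
  mono : ∀ v → IsRational (monomial v)
  plus : ∀ {f g} → IsRational f → IsRational g → IsRational (f ⊕ g)
  neg  : ∀ {f} → IsRational f → IsRational (⊖ f)
  mult : ∀ {f g} → IsRational f → IsRational g → IsRational (f ⊛ g)
  str  : ∀ {f} → IsRational f → f [] ≡ + 0 → IsRational (star f)
  ext  : ∀ {f g} → IsRational f → (∀ w → f w ≡ g w) → IsRational g

Z : ∀ {n} → Word n → Series n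
Z u w = if ⌊ u ≼? w ⌋ then + 1 else + 0

-- Normal embeddings.  Expansions η are words over ℕ (0 = empty slot).

isZero : ℕ → Bool
isZero zero = true
isZero (suc _) = false

choices : ℕ → List ℕ
choices zero = 0 ∷ []
choices (suc zero) = 1 ∷ 0 ∷ []
choices (suc (suc k)) = suc (suc k) ∷ suc k ∷ 0 ∷ []

candidates : List ℕ → List (List ℕ)
candidates [] = [] ∷ []
candidates (b ∷ w) = concatMap (λ c → map (c ∷_) (candidates w)) (choices b)

restrict : List ℕ → List ℕ
restrict = filter (λ e → Relation.Nullary.¬? (e ℕ.≟ 0))

-- condition (2): a position i is forced into the support iff
--   w(i) = 1 and i is not the first index of its run (w(i-1) = 1), or
--   w(i) ≥ 2 and i is the first index of its run (i = 0 or w(i-1) ≠ w(i)).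
-- The first argument is w(i-1) (nothing if i = 0).
forced : Maybe ℕ → ℕ → Bool
forced nothing (suc zero) = false
forced (just p) (suc zero) = ⌊ p ℕ.≟ 1 ⌋
forced nothing (suc (suc k)) = true
forced (just p) (suc (suc k)) = not ⌊ p ℕ.≟ suc (suc k) ⌋
forced _ zero = false

runCond : Maybe ℕ → List ℕ → List ℕ → Bool
runCond prev [] [] = true
runCond prev (b ∷ w) (e ∷ η) =
  (not (forced prev b) ∨ not (isZero e)) ∧ runCond (just b) w η
runCond prev _ _ = false

isNormal : List ℕ → List ℕ → List ℕ → Bool
isNormal u w η = ⌊ ≡-dec ℕ._≟_ (restrict η) u ⌋ ∧ runCond nothing w η

normalEmbeddings : List ℕ → List ℕ → List (List ℕ)
normalEmbeddings u w = filter (λ η → Relation.Nullary.Decidable.T? (isNormal u w η)) (candidates w)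
  where open import Relation.Nullary.Decidable

defect : List ℕ → List ℕ → ℕ
defect (b ∷ w) (e ∷ η) = (if ⌊ e ℕ.≟ b ∸ 1 ⌋ then 1 else 0) ℕ.+ defect w η
defect _ _ = 0

sign : ℕ → ℤ
sign zero = + 1
sign (suc k) = - sign k

M : ∀ {n} → Word n → Series n
M u w = if ⌊ u ≼? w ⌋
          then sumℤ (map (λ η → sign (defect (wordVals w) η))
                        (normalEmbeddings (wordVals u) (wordVals w)))
          else + 0

module Submission where

open import Defs
open import Data.Nat as ℕ using (ℕ; zero; suc; _≤_; s≤s)
import Data.Nat.Properties as ℕ
open import Data.Fin as Fin using (Fin; toℕ)
import Data.Fin.Properties as Fin
open import Data.Integer as ℤ using (ℤ; +_; -_; _+_; _-_; _*_; -[1+_])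
open import Data.Integer.Properties
open import Data.Integer.Tactic.RingSolver using (solve-∀)
open import Algebra.Properties.CommutativeSemigroup +-commutativeSemigroup using (interchange)
open import Algebra.Properties.Monoid.Sum +-0-monoid using (sum-syntax; sum-cong-≗; sum-replicate-zero)
open import Data.List using (List; []; _∷_; map; length; _++_; concatMap; filter; drop)
open import Data.List.Properties using (map-∘; map-++; ≡-dec; drop-map)
open import Data.Bool using (Bool; true; false; if_then_else_; _∧_; not)
open import Data.Bool.Properties using (∨-zeroʳ; if-float; if-not)
open import Data.Maybe using (Maybe; just; nothing)
open import Data.Product using (_×_; _,_; proj₁; proj₂)
open import Data.Empty using (⊥-elim)
open import Function using (_∘_; _⇔_; mk⇔)
open import Relation.Binary.PropositionalEquality
open import Relation.Nullary using (Dec; yes; no; ¬_; ¬?)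
open import Relation.Nullary.Decidable using (⌊_⌋; T?; isYes≗does; does-⇔)

-- A series f is determined by its constant term f ε and its left quotients ∂ₐ f = (w ↦ f (a w)),
-- and for f ε = 0 the star satisfies ∂ₐ (f*) = (∂ₐ f) f*.  So it suffices to exhibit rational
-- expressions whose quotients obey the same recursions as Z and M.
--
-- Embedding u greedily into w, ∂ₐ Z(c u) is Z(u) if c ≤ a and Z(c u) otherwise; this is solved
-- by Z(ε) = (Σ_a a)* and Z(c u) = (Σ_{a<c} a)* (Σ_{a≥c} a) Z(u).
--
-- For M, classify the normal embeddings η of u into a w by η(1) ∈ {0, a − 1, a}.  Condition (2)
-- at the next position only depends on the letter a just read, so the signed count N_p(u, w),
-- with p the previous letter of w, satisfies
--   N_p(u, a w) = s_p(a) N_a(u, w) + ([u₁ = a] − [u₁ + 1 = a]) N_a(u₂ u₃ ⋯, w),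
-- where s_p(a) ∈ {0, ±1} is the weight of an empty first slot.  The series
-- G_p F(u₁) ⋯ F(u_k), with F(k) = 𝐤 G_k − (𝐤+𝟏) G_{k+1}, G_1 = ε, G_k = 𝐤* (ε − 𝟏) for k ≥ 2
-- and G = ε − 𝟏 at the start, satisfies the same recursion, and both vanish unless u ≤ w.

⟦_⟧ : ∀ {P : Set} → Dec P → ℤ
⟦ P? ⟧ = if ⌊ P? ⌋ then + 1 else + 0

⟦⟧-⇔ : ∀ {P Q : Set} → P ⇔ Q → (P? : Dec P) (Q? : Dec Q) → ⟦ P? ⟧ ≡ ⟦ Q? ⟧
⟦⟧-⇔ P⇔Q P? Q? = cong (if_then + 1 else + 0)
  (trans (isYes≗does P?) (trans (does-⇔ P⇔Q P? Q?) (sym (isYes≗does Q?))))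

if-yes : ∀ {P A : Set} (P? : Dec P) {x y : A} → P → (if ⌊ P? ⌋ then x else y) ≡ x
if-yes (yes _) _ = refl
if-yes (no ¬p) p = ⊥-elim (¬p p)

if-no : ∀ {P A : Set} (P? : Dec P) {x y : A} → ¬ P → (if ⌊ P? ⌋ then x else y) ≡ y
if-no (yes p) ¬p = ⊥-elim (¬p p)
if-no (no _)  _  = refl

module _ {A : Set} where

  sumℤ-map-cong : ∀ {F G : A → ℤ} xs → (∀ x → F x ≡ G x) → sumℤ (map F xs) ≡ sumℤ (map G xs)
  sumℤ-map-cong []       F≗G = refl
  sumℤ-map-cong (x ∷ xs) F≗G = cong₂ _+_ (F≗G x) (sumℤ-map-cong xs F≗G)

  sumℤ-map-zero : ∀ {F : A → ℤ} xs → (∀ x → F x ≡ + 0) → sumℤ (map F xs) ≡ + 0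
  sumℤ-map-zero []       F≗0 = refl
  sumℤ-map-zero (x ∷ xs) F≗0 = cong₂ _+_ (F≗0 x) (sumℤ-map-zero xs F≗0)

  sumℤ-map-+ : ∀ (F G : A → ℤ) xs →
               sumℤ (map (λ x → F x + G x) xs) ≡ sumℤ (map F xs) + sumℤ (map G xs)
  sumℤ-map-+ F G []       = refl
  sumℤ-map-+ F G (x ∷ xs) =
    trans (cong (_+_ (F x + G x)) (sumℤ-map-+ F G xs)) (interchange (F x) (G x) _ _)

  sumℤ-map-* : ∀ k (F : A → ℤ) xs → sumℤ (map (λ x → k * F x) xs) ≡ k * sumℤ (map F xs)
  sumℤ-map-* k F []       = sym (*-zeroʳ k)
  sumℤ-map-* k F (x ∷ xs) =
    trans (cong (_+_ (k * F x)) (sumℤ-map-* k F xs)) (sym (*-distribˡ-+ k (F x) _))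

  sumℤ-filter : ∀ (P : A → Bool) (F : A → ℤ) xs →
                sumℤ (map F (filter (λ x → T? (P x)) xs)) ≡ sumℤ (map (λ x → if P x then F x else + 0) xs)
  sumℤ-filter P F []       = refl
  sumℤ-filter P F (x ∷ xs) with P x
  ... | true  = cong (_+_ (F x)) (sumℤ-filter P F xs)
  ... | false = trans (sumℤ-filter P F xs) (sym (+-identityˡ _))

sumℤ-++ : ∀ xs ys → sumℤ (xs ++ ys) ≡ sumℤ xs + sumℤ ys
sumℤ-++ []       ys = sym (+-identityˡ _)
sumℤ-++ (x ∷ xs) ys = trans (cong (_+_ x) (sumℤ-++ xs ys)) (sym (+-assoc x _ _))

sumℤ-concatMap : ∀ {A B : Set} (F : B → ℤ) (g : A → List B) xs →
                 sumℤ (map F (concatMap g xs)) ≡ sumℤ (map (λ x → sumℤ (map F (g x))) xs)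
sumℤ-concatMap F g []       = refl
sumℤ-concatMap F g (x ∷ xs) = begin
  sumℤ (map F (g x ++ concatMap g xs))                ≡⟨ cong sumℤ (map-++ F (g x) _) ⟩
  sumℤ (map F (g x) ++ map F (concatMap g xs))        ≡⟨ sumℤ-++ (map F (g x)) _ ⟩
  sumℤ (map F (g x)) + sumℤ (map F (concatMap g xs))
    ≡⟨ cong (_+_ (sumℤ (map F (g x)))) (sumℤ-concatMap F g xs) ⟩
  sumℤ (map F (g x)) + sumℤ (map (λ x → sumℤ (map F (g x))) xs) ∎
  where open ≡-Reasoning

∑-zero : ∀ m {F : Fin m → ℤ} → (∀ i → F i ≡ + 0) → ∑[ i < m ] F i ≡ + 0
∑-zero m F≗0 = trans (sum-cong-≗ F≗0) (sum-replicate-zero m)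

∑-⟦≟⟧ : ∀ {m} (ψ : Fin m → ℤ) a → ∑[ b < m ] (ψ b * ⟦ b Fin.≟ a ⟧) ≡ ψ a
∑-⟦≟⟧ {suc m} ψ Fin.zero    =
  trans (cong₂ _+_ (*-identityʳ (ψ Fin.zero)) (∑-zero m (λ b → *-zeroʳ (ψ (Fin.suc b)))))
        (+-identityʳ (ψ Fin.zero))
∑-⟦≟⟧ {suc m} ψ (Fin.suc a) =
  trans (cong₂ _+_ (*-zeroʳ (ψ Fin.zero)) (trans (sum-cong-≗ shift) (∑-⟦≟⟧ (ψ ∘ Fin.suc) a)))
        (+-identityˡ (ψ (Fin.suc a)))
  where
  shift : ∀ b → ψ (Fin.suc b) * ⟦ Fin.suc b Fin.≟ Fin.suc a ⟧ ≡ ψ (Fin.suc b) * ⟦ b Fin.≟ a ⟧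
  shift b = cong (ψ (Fin.suc b) *_) (⟦⟧-⇔ (mk⇔ Fin.suc-injective (cong Fin.suc)) _ (b Fin.≟ a))

module _ {n : ℕ} where

  infix 4 _≈_
  _≈_ : Series n → Series n → Set
  f ≈ g = ∀ w → f w ≡ g w

  ∂ : Fin n → Series n → Series n
  ∂ a f w = f (a ∷ w)

  ε : Series n
  ε = monomial []

  infixr 7 _·_
  _·_ : ℤ → Series n → Series n
  (k · f) w = k * f w

  ⊛-∷ : ∀ f g a w → (f ⊛ g) (a ∷ w) ≡ f [] * g (a ∷ w) + (∂ a f ⊛ g) w
  ⊛-∷ f g a w = cong (_+_ (f [] * g (a ∷ w))) (cong sumℤ (sym (map-∘ (splits w))))

  ⊛-congˡ : ∀ {f f′} g → f ≈ f′ → f ⊛ g ≈ f′ ⊛ g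
  ⊛-congˡ g f≈f′ w = sumℤ-map-cong (splits w) (λ (x , y) → cong (_* g y) (f≈f′ x))

  ⊛-congʳ-upTo : ∀ f {g h} w → (∀ y → length y ≤ length w → g y ≡ h y) → (f ⊛ g) w ≡ (f ⊛ h) w
  ⊛-congʳ-upTo f         []      g≈h = cong (λ t → f [] * t + + 0) (g≈h [] ℕ.z≤n)
  ⊛-congʳ-upTo f {g} {h} (a ∷ w) g≈h = begin
    (f ⊛ g) (a ∷ w)                   ≡⟨ ⊛-∷ f g a w ⟩
    f [] * g (a ∷ w) + (∂ a f ⊛ g) w  ≡⟨ cong₂ (λ s t → f [] * s + t) (g≈h (a ∷ w) ℕ.≤-refl)
                                               (⊛-congʳ-upTo (∂ a f) w (λ y → g≈h y ∘ ℕ.m≤n⇒m≤1+n)) ⟩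
    f [] * h (a ∷ w) + (∂ a f ⊛ h) w  ≡⟨ ⊛-∷ f h a w ⟨
    (f ⊛ h) (a ∷ w)                   ∎
    where open ≡-Reasoning

  ⊛-vanish-upTo : ∀ f {g} w → (∀ y → length y ≤ length w → g y ≡ + 0) → (f ⊛ g) w ≡ + 0
  ⊛-vanish-upTo f w g≈0 =
    trans (⊛-congʳ-upTo f w g≈0) (sumℤ-map-zero (splits w) (λ (x , _) → *-zeroʳ (f x)))

  ⊛-distribˡ-⊕ : ∀ f g h → f ⊛ (g ⊕ h) ≈ (f ⊛ g) ⊕ (f ⊛ h)
  ⊛-distribˡ-⊕ f g h w =
    trans (sumℤ-map-cong (splits w) (λ (x , y) → *-distribˡ-+ (f x) (g y) (h y)))
          (sumℤ-map-+ (λ p → f (proj₁ p) * g (proj₂ p)) (λ p → f (proj₁ p) * h (proj₂ p)) (splits w))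

  ·-⊛ : ∀ k f g → (k · f) ⊛ g ≈ k · (f ⊛ g)
  ·-⊛ k f g w = trans (sumℤ-map-cong (splits w) (λ (x , y) → *-assoc k (f x) (g y)))
                      (sumℤ-map-* k (λ p → f (proj₁ p) * g (proj₂ p)) (splits w))

  ε-⊛ : ∀ g → ε ⊛ g ≈ g
  ε-⊛ g []      = trans (+-identityʳ _) (*-identityˡ _)
  ε-⊛ g (a ∷ w) = begin
    (ε ⊛ g) (a ∷ w)                  ≡⟨ ⊛-∷ ε g a w ⟩
    + 1 * g (a ∷ w) + (∂ a ε ⊛ g) w  ≡⟨ cong₂ _+_ (*-identityˡ (g (a ∷ w)))
                                                 (⊛-congˡ {∂ a ε} {+ 0 · ε} g (λ _ → refl) w) ⟩
    g (a ∷ w) + ((+ 0 · ε) ⊛ g) w    ≡⟨ cong (_+_ (g (a ∷ w))) (·-⊛ (+ 0) ε g w) ⟩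
    g (a ∷ w) + + 0                  ≡⟨ +-identityʳ _ ⟩
    g (a ∷ w)                        ∎
    where open ≡-Reasoning

  ⊛-∷-scaled : ∀ f g a k h → ∂ a f ≈ k · h →
               ∀ w → (f ⊛ g) (a ∷ w) ≡ f [] * g (a ∷ w) + k * (h ⊛ g) w
  ⊛-∷-scaled f g a k h ∂f≈kh w =
    trans (⊛-∷ f g a w) (cong (_+_ (f [] * g (a ∷ w))) (trans (⊛-congˡ g ∂f≈kh w) (·-⊛ k h g w)))

  partialStar : Series n → ℕ → Series n
  partialStar f zero    = pow f zero
  partialStar f (suc N) = pow f (suc N) ⊕ partialStar f N

  partialStar-unique : ∀ f w (c : ℕ → ℤ) → c zero ≡ pow f zero w →
                       (∀ k → c (suc k) ≡ pow f (suc k) w + c k) → ∀ N → c N ≡ partialStar f N w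
  partialStar-unique f w c c₀ cₛ zero    = c₀
  partialStar-unique f w c c₀ cₛ (suc N) =
    trans (cₛ N) (cong (_+_ (pow f (suc N) w)) (partialStar-unique f w c c₀ cₛ N))

  -- Abstracting `length w` exposes the local recursion of `star` to `partialStar-unique`.
  star≡partialStar : ∀ f w → star f w ≡ partialStar f (length w) w
  star≡partialStar f w with length w | partialStar-unique f w _ refl (λ _ → refl)
  ... | N | local≡partialStar = local≡partialStar N

  module _ (f : Series n) (f[]≡0 : f [] ≡ + 0) where

    pow-∷ : ∀ k a w → pow f (suc k) (a ∷ w) ≡ (∂ a f ⊛ pow f k) w
    pow-∷ k a w = trans (⊛-∷ f (pow f k) a w)
      (trans (cong (λ c → c * pow f k (a ∷ w) + (∂ a f ⊛ pow f k) w) f[]≡0) (+-identityˡ _))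

    pow-vanish : ∀ k y → length y ℕ.< k → pow f k y ≡ + 0
    pow-vanish (suc k) []      _           = cong (λ c → c * pow f k [] + + 0) f[]≡0
    pow-vanish (suc k) (a ∷ y) (s≤s |y|<k) = trans (pow-∷ k a y)
      (⊛-vanish-upTo (∂ a f) y (λ z |z|≤|y| → pow-vanish k z (ℕ.≤-<-trans |z|≤|y| |y|<k)))

    partialStar-stable : ∀ d y → partialStar f (d ℕ.+ length y) y ≡ partialStar f (length y) y
    partialStar-stable zero    y = refl
    partialStar-stable (suc d) y =
      trans (cong (_+ partialStar f (d ℕ.+ length y) y) (pow-vanish _ y (s≤s (ℕ.m≤n+m _ d))))
            (trans (+-identityˡ _) (partialStar-stable d y))

    partialStar≡star : ∀ N y → length y ≤ N → partialStar f N y ≡ star f y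
    partialStar≡star N y |y|≤N = begin
      partialStar f N y                              ≡⟨ cong (λ M → partialStar f M y) (ℕ.m∸n+n≡m |y|≤N) ⟨
      partialStar f (N ℕ.∸ length y ℕ.+ length y) y  ≡⟨ partialStar-stable (N ℕ.∸ length y) y ⟩
      partialStar f (length y) y                     ≡⟨ star≡partialStar f y ⟨
      star f y                                       ∎
      where open ≡-Reasoning

    partialStar-∷ : ∀ N a w → partialStar f (suc N) (a ∷ w) ≡ (∂ a f ⊛ partialStar f N) w
    partialStar-∷ zero    a w = trans (+-identityʳ _) (pow-∷ zero a w)
    partialStar-∷ (suc N) a w =
      trans (cong₂ _+_ (pow-∷ (suc N) a w) (partialStar-∷ N a w))
            (sym (⊛-distribˡ-⊕ (∂ a f) (pow f (suc N)) (partialStar f N) w))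

    star-∂ : ∀ a → ∂ a (star f) ≈ ∂ a f ⊛ star f
    star-∂ a w = begin
      star f (a ∷ w)                          ≡⟨ star≡partialStar f (a ∷ w) ⟩
      partialStar f (suc (length w)) (a ∷ w)  ≡⟨ partialStar-∷ (length w) a w ⟩
      (∂ a f ⊛ partialStar f (length w)) w    ≡⟨ ⊛-congʳ-upTo (∂ a f) w (partialStar≡star (length w)) ⟩
      (∂ a f ⊛ star f) w                      ∎
      where open ≡-Reasoning

  zero-rational : IsRational {n} (λ _ → + 0)
  zero-rational = ext (plus (mono []) (neg (mono []))) (λ w → +-inverseʳ (ε w))

  ·ℕ-rational : ∀ m {f} → IsRational f → IsRational (+ m · f)
  ·ℕ-rational zero        _     = zero-rational
  ·ℕ-rational (suc m) {f} f-rat = ext (plus f-rat (·ℕ-rational m f-rat))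
    (λ w → trans (cong (_+ + m * f w) (sym (*-identityˡ (f w)))) (sym (*-distribʳ-+ (f w) (+ 1) (+ m))))

  ·-rational : ∀ k {f} → IsRational f → IsRational (k · f)
  ·-rational (+ m)        f-rat = ·ℕ-rational m f-rat
  ·-rational -[1+ m ] {f} f-rat = ext (neg (·ℕ-rational (suc m) f-rat)) (λ w → neg-distribˡ-* (+ suc m) (f w))

  ∑-rational : ∀ m (F : Fin m → Series n) → (∀ i → IsRational (F i)) →
               IsRational (λ w → ∑[ i < m ] F i w)
  ∑-rational zero    F F-rat = zero-rational
  ∑-rational (suc m) F F-rat = plus (F-rat Fin.zero) (∑-rational m (F ∘ Fin.suc) (F-rat ∘ Fin.suc))

  linear : (Fin n → ℤ) → Series n
  linear φ (a ∷ []) = φ a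
  linear φ _        = + 0

  linear-∂ : ∀ φ a → ∂ a (linear φ) ≈ φ a · ε
  linear-∂ φ a []      = sym (*-identityʳ (φ a))
  linear-∂ φ a (_ ∷ _) = sym (*-zeroʳ (φ a))

  linear-∂-⊛ : ∀ φ a g → ∂ a (linear φ) ⊛ g ≈ φ a · g
  linear-∂-⊛ φ a g w =
    trans (⊛-congˡ g (linear-∂ φ a) w) (trans (·-⊛ (φ a) ε g w) (cong (φ a *_) (ε-⊛ g w)))

  linear-⊛-∷ : ∀ φ g a w → (linear φ ⊛ g) (a ∷ w) ≡ φ a * g w
  linear-⊛-∷ φ g a w = trans (⊛-∷ (linear φ) g a w) (trans (+-identityˡ _) (linear-∂-⊛ φ a g w))

  star-linear-∂ : ∀ φ a → ∂ a (star (linear φ)) ≈ φ a · star (linear φ)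
  star-linear-∂ φ a w = trans (star-∂ (linear φ) refl a w) (linear-∂-⊛ φ a (star (linear φ)) w)

  monomial-letter : ∀ b → monomial (b ∷ []) ≈ linear (λ a → ⟦ b Fin.≟ a ⟧)
  monomial-letter b []          = refl
  monomial-letter b (a ∷ [])    with b Fin.≟ a
  ... | yes _ = refl
  ... | no  _ = refl
  monomial-letter b (a ∷ _ ∷ _) with b Fin.≟ a
  ... | yes _ = refl
  ... | no  _ = refl

  linear-rational : ∀ φ → IsRational (linear φ)
  linear-rational φ =
    ext (∑-rational n (λ b → φ b · monomial (b ∷ [])) (λ b → ·-rational (φ b) (mono (b ∷ []))))
        (λ w → trans (sum-cong-≗ (λ b → cong (φ b *_) (monomial-letter b w))) (∑-letters w))
    where
    ∑-letters : ∀ w → ∑[ b < n ] (φ b * linear (λ a → ⟦ b Fin.≟ a ⟧) w) ≡ linear φ w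
    ∑-letters []          = ∑-zero n (λ b → *-zeroʳ (φ b))
    ∑-letters (a ∷ [])    = ∑-⟦≟⟧ φ a
    ∑-letters (_ ∷ _ ∷ _) = ∑-zero n (λ b → *-zeroʳ (φ b))

module _ {n : ℕ} {c : Fin n} {u : Word n} where

  ≼-∷ˡ : ∀ {w} → c ∷ u ≼ w → u ≼ w
  ≼-∷ˡ (skip p)   = skip (≼-∷ˡ p)
  ≼-∷ˡ (keep _ p) = skip p

  ≼-∷-≤ : ∀ {a w} → c Fin.≤ a → (c ∷ u ≼ a ∷ w) ⇔ (u ≼ w)
  ≼-∷-≤ c≤a = mk⇔ (λ { (skip p) → ≼-∷ˡ p ; (keep _ p) → p }) (keep c≤a)

  ≼-∷-≰ : ∀ {a w} → ¬ c Fin.≤ a → (c ∷ u ≼ a ∷ w) ⇔ (c ∷ u ≼ w)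
  ≼-∷-≰ c≰a = mk⇔ (λ { (skip p) → p ; (keep c≤a _) → ⊥-elim (c≰a c≤a) }) skip

select : ∀ {P : Set} (P? : Dec P) (X Y : ℤ) →
         + 1 * (⟦ P? ⟧ * X) + ⟦ ¬? P? ⟧ * Y ≡ (if ⌊ P? ⌋ then X else Y)
select (yes _) X Y = trans (cong (_+ + 0) (trans (*-identityˡ _) (*-identityˡ X))) (+-identityʳ X)
select (no  _) X Y = trans (+-identityˡ _) (*-identityˡ Y)

module _ {n : ℕ} where

  Z-∷ : ∀ (c : Fin n) u a w → Z (c ∷ u) (a ∷ w) ≡ (if ⌊ c Fin.≤? a ⌋ then Z u w else Z (c ∷ u) w)
  Z-∷ c u a w = by-cases (c Fin.≤? a)
    where
    by-cases : (c≤?a : Dec (c Fin.≤ a)) →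
               Z (c ∷ u) (a ∷ w) ≡ (if ⌊ c≤?a ⌋ then Z u w else Z (c ∷ u) w)
    by-cases (yes c≤a) = ⟦⟧-⇔ (≼-∷-≤ c≤a) ((c ∷ u) ≼? (a ∷ w)) (u ≼? w)
    by-cases (no  c≰a) = ⟦⟧-⇔ (≼-∷-≰ c≰a) ((c ∷ u) ≼? (a ∷ w)) ((c ∷ u) ≼? w)

  lettersBelow lettersFrom : Fin n → Series n
  lettersBelow c = linear (λ a → ⟦ ¬? (c Fin.≤? a) ⟧)
  lettersFrom  c = linear (λ a → ⟦ c Fin.≤? a ⟧)

  zetaSeries : Word n → Series n
  zetaSeries []      = star (linear (λ _ → + 1))
  zetaSeries (c ∷ u) = star (lettersBelow c) ⊛ (lettersFrom c ⊛ zetaSeries u)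

  zetaSeries-rational : ∀ u → IsRational (zetaSeries u)
  zetaSeries-rational []      = str (linear-rational _) refl
  zetaSeries-rational (c ∷ u) =
    mult (str (linear-rational _) refl) (mult (linear-rational _) (zetaSeries-rational u))

  zetaSeries-∷ : ∀ c u a w → zetaSeries (c ∷ u) (a ∷ w) ≡
                 (if ⌊ c Fin.≤? a ⌋ then zetaSeries u w else zetaSeries (c ∷ u) w)
  zetaSeries-∷ c u a w = begin
    zetaSeries (c ∷ u) (a ∷ w)
      ≡⟨ ⊛-∷-scaled (star (lettersBelow c)) (lettersFrom c ⊛ zetaSeries u) a ⟦ ¬? (c Fin.≤? a) ⟧
                    (star (lettersBelow c)) (star-linear-∂ _ a) w ⟩
    + 1 * (lettersFrom c ⊛ zetaSeries u) (a ∷ w) + ⟦ ¬? (c Fin.≤? a) ⟧ * zetaSeries (c ∷ u) w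
      ≡⟨ cong (λ t → + 1 * t + ⟦ ¬? (c Fin.≤? a) ⟧ * zetaSeries (c ∷ u) w)
              (linear-⊛-∷ _ (zetaSeries u) a w) ⟩
    + 1 * (⟦ c Fin.≤? a ⟧ * zetaSeries u w) + ⟦ ¬? (c Fin.≤? a) ⟧ * zetaSeries (c ∷ u) w
      ≡⟨ select (c Fin.≤? a) (zetaSeries u w) (zetaSeries (c ∷ u) w) ⟩
    (if ⌊ c Fin.≤? a ⌋ then zetaSeries u w else zetaSeries (c ∷ u) w) ∎
    where open ≡-Reasoning

  zetaSeries≈Z : ∀ u → zetaSeries u ≈ Z u
  zetaSeries≈Z []      []      = refl
  zetaSeries≈Z (c ∷ u) []      = refl
  zetaSeries≈Z []      (a ∷ w) =
    trans (star-linear-∂ (λ _ → + 1) a w) (trans (*-identityˡ _) (zetaSeries≈Z [] w))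
  zetaSeries≈Z (c ∷ u) (a ∷ w) = begin
    zetaSeries (c ∷ u) (a ∷ w)                                          ≡⟨ zetaSeries-∷ c u a w ⟩
    (if ⌊ c Fin.≤? a ⌋ then zetaSeries u w else zetaSeries (c ∷ u) w)
      ≡⟨ cong₂ (if ⌊ c Fin.≤? a ⌋ then_else_) (zetaSeries≈Z u w) (zetaSeries≈Z (c ∷ u) w) ⟩
    (if ⌊ c Fin.≤? a ⌋ then Z u w else Z (c ∷ u) w)                     ≡⟨ Z-∷ c u a w ⟨
    Z (c ∷ u) (a ∷ w)                                                   ∎
    where open ≡-Reasoning

  Z-rational : ∀ u → IsRational (Z u)
  Z-rational u = ext (zetaSeries-rational u) (zetaSeries≈Z u)

δ : ℕ → ℕ → ℤ
δ x y = ⟦ x ℕ.≟ y ⟧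

δ-subst : ∀ x y (F : ℕ → ℤ) → δ x y * F y ≡ δ x y * F x
δ-subst x y F with x ℕ.≟ y
... | yes refl = refl
... | no  _    = refl

δ-suc : ∀ x y → δ (suc x) (suc y) ≡ δ x y
δ-suc x y = ⟦⟧-⇔ (mk⇔ ℕ.suc-injective (cong suc)) (suc x ℕ.≟ suc y) (x ℕ.≟ y)

δ-< : ∀ {x y} → x ℕ.< y → δ x y ≡ + 0
δ-< {x} {y} x<y = if-no (x ℕ.≟ y) (ℕ.<⇒≢ x<y)

slotDefect : ℕ → ℕ → ℕ
slotDefect b c = if ⌊ c ℕ.≟ b ℕ.∸ 1 ⌋ then 1 else 0

skipWeight : Maybe ℕ → ℕ → ℤ
skipWeight p b = if forced p b then + 0 else sign (slotDefect b 0)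

headWeight : ∀ {n} → Word n → ℕ → ℤ
headWeight []      b = + 0
headWeight (c ∷ _) b = δ b (letterVal c) - δ b (suc (letterVal c))

skipWeight-≥2 : ∀ j k → skipWeight (just (2 ℕ.+ k)) (2 ℕ.+ j) ≡ δ (2 ℕ.+ j) (2 ℕ.+ k)
skipWeight-≥2 j k = trans (if-not ⌊ 2 ℕ.+ k ℕ.≟ 2 ℕ.+ j ⌋)
                          (⟦⟧-⇔ (mk⇔ sym sym) (2 ℕ.+ k ℕ.≟ 2 ℕ.+ j) (2 ℕ.+ j ℕ.≟ 2 ℕ.+ k))

-- In guard, normalSeries and normalCount, p is the previous letter of w (nothing at the start),
-- as in runCond.
module _ {n : ℕ} where

  -- the zero series if no letter has value k
  letter : ℕ → Series n
  letter k = linear (λ a → δ (letterVal a) k)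

  ε-𝟏 : Series n
  ε-𝟏 = ε ⊕ (⊖ letter 1)

  guard : Maybe ℕ → Series n
  guard (just 1)             = ε
  guard (just (suc (suc k))) = star (letter (suc (suc k))) ⊛ ε-𝟏
  guard _                    = ε-𝟏

  factor : ℕ → Series n
  factor k = (letter k ⊛ guard (just k)) ⊕ (⊖ (letter (suc k) ⊛ guard (just (suc k))))

  factors : Word n → Series n
  factors []      = ε
  factors (c ∷ u) = factor (letterVal c) ⊛ factors u

  normalSeries : Maybe ℕ → Word n → Series n
  normalSeries p u = guard p ⊛ factors u

  guard-rational : ∀ p → IsRational (guard p)
  guard-rational nothing              = plus (mono []) (neg (linear-rational _))
  guard-rational (just zero)          = plus (mono []) (neg (linear-rational _))
  guard-rational (just (suc zero))    = mono []
  guard-rational (just (suc (suc k))) =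
    mult (str (linear-rational _) refl) (plus (mono []) (neg (linear-rational _)))

  factor-rational : ∀ k → IsRational (factor k)
  factor-rational k = plus (mult (linear-rational _) (guard-rational (just k)))
                           (neg (mult (linear-rational _) (guard-rational (just (suc k)))))

  normalSeries-rational : ∀ p u → IsRational (normalSeries p u)
  normalSeries-rational p u = mult (guard-rational p) (factors-rational u)
    where
    factors-rational : ∀ u → IsRational (factors u)
    factors-rational []      = mono []
    factors-rational (c ∷ u) = mult (factor-rational (letterVal c)) (factors-rational u)

  guard-[] : ∀ p → guard p [] ≡ + 1
  guard-[] nothing              = refl
  guard-[] (just zero)          = refl
  guard-[] (just (suc zero))    = refl
  guard-[] (just (suc (suc k))) = refl

  ε-𝟏-∂ : ∀ a → ∂ a ε-𝟏 ≈ (- δ (letterVal a) 1) · ε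
  ε-𝟏-∂ a x =
    trans (+-identityˡ _) (trans (cong -_ (linear-∂ _ a x)) (neg-distribˡ-* (δ (letterVal a) 1) (ε x)))

  guard-∂ : ∀ p a → ∂ a (guard p) ≈ skipWeight p (letterVal a) · guard (just (letterVal a))
  guard-∂ nothing              a x = trans (ε-𝟏-∂ a x) (at-start (toℕ a))
    where
    at-start : ∀ j → (- δ (suc j) 1) * ε x ≡ skipWeight nothing (suc j) * guard (just (suc j)) x
    at-start zero    = refl
    at-start (suc _) = refl
  guard-∂ (just zero)          a x = trans (ε-𝟏-∂ a x) (at-start (toℕ a))
    where
    at-start : ∀ j → (- δ (suc j) 1) * ε x ≡ skipWeight (just zero) (suc j) * guard (just (suc j)) x
    at-start zero    = refl
    at-start (suc _) = refl
  guard-∂ (just (suc zero))    a x = after-1 (toℕ a)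
    where
    after-1 : ∀ j → ε (a ∷ x) ≡ skipWeight (just 1) (suc j) * guard (just (suc j)) x
    after-1 zero    = refl
    after-1 (suc _) = refl
  guard-∂ (just (suc (suc k))) a x = begin
    (star L ⊛ ε-𝟏) (a ∷ x)
      ≡⟨ ⊛-∷-scaled (star L) ε-𝟏 a (δ (letterVal a) (2 ℕ.+ k)) (star L) (star-linear-∂ _ a) x ⟩
    + 1 * ε-𝟏 (a ∷ x) + δ (letterVal a) (2 ℕ.+ k) * G (2 ℕ.+ k)
      ≡⟨ cong (λ t → + 1 * t + δ (letterVal a) (2 ℕ.+ k) * G (2 ℕ.+ k)) (ε-𝟏-∂ a x) ⟩
    + 1 * ((- δ (letterVal a) 1) * ε x) + δ (letterVal a) (2 ℕ.+ k) * G (2 ℕ.+ k)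
      ≡⟨ after-≥2 (toℕ a) ⟩
    skipWeight (just (2 ℕ.+ k)) (letterVal a) * G (letterVal a) ∎
    where
    open ≡-Reasoning
    L = letter (2 ℕ.+ k)
    G : ℕ → ℤ
    G m = guard (just m) x
    after-≥2 : ∀ j → + 1 * ((- δ (suc j) 1) * ε x) + δ (suc j) (2 ℕ.+ k) * G (2 ℕ.+ k)
                     ≡ skipWeight (just (2 ℕ.+ k)) (suc j) * G (suc j)
    after-≥2 zero    = trans (+-identityʳ _) (*-identityˡ _)
    after-≥2 (suc j) = begin
      + 0 + δ (2 ℕ.+ j) (2 ℕ.+ k) * G (2 ℕ.+ k)    ≡⟨ +-identityˡ _ ⟩
      δ (2 ℕ.+ j) (2 ℕ.+ k) * G (2 ℕ.+ k)          ≡⟨ δ-subst (2 ℕ.+ j) (2 ℕ.+ k) G ⟩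
      δ (2 ℕ.+ j) (2 ℕ.+ k) * G (2 ℕ.+ j)          ≡⟨ cong (_* G (2 ℕ.+ j)) (skipWeight-≥2 j k) ⟨
      skipWeight (just (2 ℕ.+ k)) (2 ℕ.+ j) * G (2 ℕ.+ j) ∎

  factor-∂ : ∀ k a →
             ∂ a (factor k) ≈ (δ (letterVal a) k - δ (letterVal a) (suc k)) · guard (just (letterVal a))
  factor-∂ k a x = begin
    (letter k ⊛ guard (just k)) (a ∷ x) + - (letter (suc k) ⊛ guard (just (suc k))) (a ∷ x)
      ≡⟨ cong₂ (λ s t → s + - t) (linear-⊛-∷ _ (guard (just k)) a x)
                                 (linear-⊛-∷ _ (guard (just (suc k))) a x) ⟩
    δ b k * G k + - (δ b (suc k) * G (suc k))
      ≡⟨ cong₂ (λ s t → s + - t) (δ-subst b k G) (δ-subst b (suc k) G) ⟩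
    δ b k * G b + - (δ b (suc k) * G b)
      ≡⟨ cong (_+_ (δ b k * G b)) (neg-distribˡ-* (δ b (suc k)) (G b)) ⟩
    δ b k * G b + (- δ b (suc k)) * G b
      ≡⟨ *-distribʳ-+ (G b) (δ b k) (- δ b (suc k)) ⟨
    (δ b k - δ b (suc k)) * G b ∎
    where
    open ≡-Reasoning
    b = letterVal a
    G : ℕ → ℤ
    G m = guard (just m) x

  factors-∷ : ∀ u a w →
              factors u (a ∷ w) ≡ headWeight u (letterVal a) * normalSeries (just (letterVal a)) (drop 1 u) w
  factors-∷ []      a w = refl
  factors-∷ (c ∷ u) a w =
    trans (⊛-∷-scaled (factor (letterVal c)) (factors u) a (headWeight (c ∷ u) (letterVal a))
                      (guard (just (letterVal a))) (factor-∂ (letterVal c) a) w)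
          (+-identityˡ _)

  normalSeries-∷ : ∀ p u a w → normalSeries p u (a ∷ w) ≡
                   skipWeight p (letterVal a) * normalSeries (just (letterVal a)) u w
                   + headWeight u (letterVal a) * normalSeries (just (letterVal a)) (drop 1 u) w
  normalSeries-∷ p u a w = begin
    (guard p ⊛ factors u) (a ∷ w)
      ≡⟨ ⊛-∷-scaled (guard p) (factors u) a (skipWeight p b) (guard (just b)) (guard-∂ p a) w ⟩
    guard p [] * factors u (a ∷ w) + skipTerm
      ≡⟨ cong (_+ skipTerm) (trans (cong (_* factors u (a ∷ w)) (guard-[] p))
                                   (trans (*-identityˡ _) (factors-∷ u a w))) ⟩
    headTerm + skipTerm
      ≡⟨ +-comm headTerm skipTerm ⟩
    skipTerm + headTerm ∎
    where
    open ≡-Reasoning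
    b = letterVal a
    skipTerm = skipWeight p b * normalSeries (just b) u w
    headTerm = headWeight u b * normalSeries (just b) (drop 1 u) w

sign-+ : ∀ m n → sign (m ℕ.+ n) ≡ sign m * sign n
sign-+ zero    n = sym (*-identityˡ (sign n))
sign-+ (suc m) n = trans (cong -_ (sign-+ m n)) (neg-distribˡ-* (sign m) (sign n))

guarded-sign : ∀ C s d → (if C then sign (s ℕ.+ d) else + 0) ≡ sign s * (if C then sign d else + 0)
guarded-sign true  s d = sign-+ s d
guarded-sign false s d = sym (*-zeroʳ (sign s))

⌊≡-dec-∷⌋ : ∀ x y xs ys →
            ⌊ ≡-dec ℕ._≟_ (x ∷ xs) (y ∷ ys) ⌋ ≡ ⌊ x ℕ.≟ y ⌋ ∧ ⌊ ≡-dec ℕ._≟_ xs ys ⌋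
⌊≡-dec-∷⌋ x y xs ys = trans (isYes≗does (≡-dec ℕ._≟_ (x ∷ xs) (y ∷ ys)))
                            (sym (cong₂ _∧_ (isYes≗does (x ℕ.≟ y)) (isYes≗does (≡-dec ℕ._≟_ xs ys))))

normalSign : Maybe ℕ → List ℕ → List ℕ → List ℕ → ℤ
normalSign p v ws η = if ⌊ ≡-dec ℕ._≟_ (restrict η) v ⌋ ∧ runCond p ws η then sign (defect ws η) else + 0

normalCount : Maybe ℕ → List ℕ → List ℕ → ℤ
normalCount p v ws = sumℤ (map (normalSign p v ws) (candidates ws))

slotWeight : Maybe ℕ → List ℕ → ℕ → ℕ → ℤ
slotWeight p v       b zero    = skipWeight p b
slotWeight p []      b (suc c) = + 0
slotWeight p (d ∷ _) b (suc c) = if ⌊ suc c ℕ.≟ d ⌋ then sign (slotDefect b (suc c)) else + 0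

remaining : ℕ → List ℕ → List ℕ
remaining zero    v = v
remaining (suc _) v = drop 1 v

normalSign-∷ : ∀ p v b ws c η →
               normalSign p v (b ∷ ws) (c ∷ η) ≡ slotWeight p v b c * normalSign (just b) (remaining c v) ws η
normalSign-∷ p v b ws zero η with forced p b | ⌊ ≡-dec ℕ._≟_ (restrict η) v ⌋
... | true  | true  = refl
... | true  | false = refl
... | false | R     = guarded-sign (R ∧ runCond (just b) ws η) (slotDefect b 0) (defect ws η)
normalSign-∷ p []      b ws (suc c) η = refl
normalSign-∷ p (d ∷ v) b ws (suc c) η
  rewrite ⌊≡-dec-∷⌋ (suc c) d (restrict η) v | ∨-zeroʳ (not (forced p b))
  with ⌊ suc c ℕ.≟ d ⌋
... | true  = guarded-sign _ (slotDefect b (suc c)) (defect ws η)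
... | false = refl

normalCount-∷ : ∀ p v b ws → normalCount p v (b ∷ ws) ≡
                sumℤ (map (λ c → slotWeight p v b c * normalCount (just b) (remaining c v) ws) (choices b))
normalCount-∷ p v b ws =
  trans (sumℤ-concatMap (normalSign p v (b ∷ ws)) (λ c → map (c ∷_) (candidates ws)) (choices b))
        (sumℤ-map-cong (choices b) slot)
  where
  slot : ∀ c → sumℤ (map (normalSign p v (b ∷ ws)) (map (c ∷_) (candidates ws)))
               ≡ slotWeight p v b c * normalCount (just b) (remaining c v) ws
  slot c = begin
    sumℤ (map (normalSign p v (b ∷ ws)) (map (c ∷_) (candidates ws)))
      ≡⟨ cong sumℤ (map-∘ (candidates ws)) ⟨
    sumℤ (map (λ η → normalSign p v (b ∷ ws) (c ∷ η)) (candidates ws))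
      ≡⟨ sumℤ-map-cong (candidates ws) (normalSign-∷ p v b ws c) ⟩
    sumℤ (map (λ η → slotWeight p v b c * normalSign (just b) (remaining c v) ws η) (candidates ws))
      ≡⟨ sumℤ-map-* (slotWeight p v b c) (normalSign (just b) (remaining c v) ws) (candidates ws) ⟩
    slotWeight p v b c * normalCount (just b) (remaining c v) ws ∎
    where open ≡-Reasoning

slotDefect-diag : ∀ k → slotDefect (2 ℕ.+ k) (2 ℕ.+ k) ≡ 0
slotDefect-diag k = if-no (2 ℕ.+ k ℕ.≟ 1 ℕ.+ k) ℕ.1+n≢n

slotDefect-pred : ∀ k → slotDefect (2 ℕ.+ k) (1 ℕ.+ k) ≡ 1
slotDefect-pred k = if-yes (1 ℕ.+ k ℕ.≟ 1 ℕ.+ k) refl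

module _ {n : ℕ} where

  slotWeight-1≡headWeight : ∀ p (u : Word n) → slotWeight p (wordVals u) 1 1 ≡ headWeight u 1
  slotWeight-1≡headWeight p []      = refl
  slotWeight-1≡headWeight p (c ∷ u) = sym (+-identityʳ _)

  slotWeights-≥2≡headWeight : ∀ p (u : Word n) k →
    slotWeight p (wordVals u) (2 ℕ.+ k) (2 ℕ.+ k) + slotWeight p (wordVals u) (2 ℕ.+ k) (1 ℕ.+ k)
    ≡ headWeight u (2 ℕ.+ k)
  slotWeights-≥2≡headWeight p []      k = refl
  slotWeights-≥2≡headWeight p (c ∷ u) k = begin
    (if ⌊ 2 ℕ.+ k ℕ.≟ c′ ⌋ then sign (slotDefect (2 ℕ.+ k) (2 ℕ.+ k)) else + 0)
      + (if ⌊ 1 ℕ.+ k ℕ.≟ c′ ⌋ then sign (slotDefect (2 ℕ.+ k) (1 ℕ.+ k)) else + 0)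
      ≡⟨ cong₂ (λ s t → (if ⌊ 2 ℕ.+ k ℕ.≟ c′ ⌋ then sign s else + 0)
                        + (if ⌊ 1 ℕ.+ k ℕ.≟ c′ ⌋ then sign t else + 0))
               (slotDefect-diag k) (slotDefect-pred k) ⟩
    δ (2 ℕ.+ k) c′ + (if ⌊ 1 ℕ.+ k ℕ.≟ c′ ⌋ then - + 1 else - + 0)
      ≡⟨ cong (_+_ (δ (2 ℕ.+ k) c′)) (if-float -_ ⌊ 1 ℕ.+ k ℕ.≟ c′ ⌋) ⟨
    δ (2 ℕ.+ k) c′ - δ (1 ℕ.+ k) c′
      ≡⟨ cong (_-_ (δ (2 ℕ.+ k) c′)) (δ-suc (1 ℕ.+ k) c′) ⟨
    δ (2 ℕ.+ k) c′ - δ (2 ℕ.+ k) (suc c′) ∎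
    where
    open ≡-Reasoning
    c′ = letterVal c

  normalCount-∷-letter : ∀ p (u : Word n) j ws → normalCount p (wordVals u) (suc j ∷ ws) ≡
                         skipWeight p (suc j) * normalCount (just (suc j)) (wordVals u) ws
                         + headWeight u (suc j) * normalCount (just (suc j)) (wordVals (drop 1 u)) ws
  normalCount-∷-letter p u j ws =
    trans (normalCount-∷ p (wordVals u) (suc j) ws)
          (trans (by-choices j)
                 (cong (λ r → skipWeight p (suc j) * X j + headWeight u (suc j) * normalCount (just (suc j)) r ws)
                       (drop-map 1 u)))
    where
    X Y : ℕ → ℤ
    X j = normalCount (just (suc j)) (wordVals u) ws
    Y j = normalCount (just (suc j)) (drop 1 (wordVals u)) ws
    swap : ∀ s γ X Y → s * Y + (γ * X + + 0) ≡ γ * X + s * Y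
    swap = solve-∀
    regroup : ∀ s t γ X Y → s * Y + (t * Y + (γ * X + + 0)) ≡ γ * X + (s + t) * Y
    regroup = solve-∀
    by-choices : ∀ j → sumℤ (map (λ c → slotWeight p (wordVals u) (suc j) c
                                        * normalCount (just (suc j)) (remaining c (wordVals u)) ws)
                                 (choices (suc j)))
                       ≡ skipWeight p (suc j) * X j + headWeight u (suc j) * Y j
    by-choices zero    = trans (swap (slotWeight p (wordVals u) 1 1) (skipWeight p 1) (X 0) (Y 0))
                               (cong (λ h → skipWeight p 1 * X 0 + h * Y 0) (slotWeight-1≡headWeight p u))
    by-choices (suc k) = trans (regroup (slotWeight p (wordVals u) (2 ℕ.+ k) (2 ℕ.+ k))
                                        (slotWeight p (wordVals u) (2 ℕ.+ k) (1 ℕ.+ k))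
                                        (skipWeight p (2 ℕ.+ k)) (X (suc k)) (Y (suc k)))
                               (cong (λ h → skipWeight p (2 ℕ.+ k) * X (suc k) + h * Y (suc k))
                                     (slotWeights-≥2≡headWeight p u k))

  normalCount≡normalSeries : ∀ w p (u : Word n) → normalCount p (wordVals u) (wordVals w) ≡ normalSeries p u w
  normalCount≡normalSeries []      p []      = sym (cong (λ g → g * + 1 + + 0) (guard-[] p))
  normalCount≡normalSeries []      p (c ∷ u) = sym (cong (λ g → g * factors (c ∷ u) [] + + 0) (guard-[] p))
  normalCount≡normalSeries (a ∷ w) p u       = begin
    normalCount p (wordVals u) (wordVals (a ∷ w))
      ≡⟨ normalCount-∷-letter p u (toℕ a) (wordVals w) ⟩
    skipWeight p b * normalCount (just b) (wordVals u) (wordVals w)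
      + headWeight u b * normalCount (just b) (wordVals (drop 1 u)) (wordVals w)
      ≡⟨ cong₂ (λ s t → skipWeight p b * s + headWeight u b * t)
               (normalCount≡normalSeries w (just b) u) (normalCount≡normalSeries w (just b) (drop 1 u)) ⟩
    skipWeight p b * normalSeries (just b) u w + headWeight u b * normalSeries (just b) (drop 1 u) w
      ≡⟨ normalSeries-∷ p u a w ⟨
    normalSeries p u (a ∷ w) ∎
    where
    open ≡-Reasoning
    b = letterVal a

  headWeight-vanish : ∀ {c a : Fin n} u → toℕ a ℕ.< toℕ c → headWeight (c ∷ u) (letterVal a) ≡ + 0
  headWeight-vanish u a<c = cong₂ _-_ (δ-< (s≤s a<c)) (δ-< (ℕ.m<n⇒m<1+n (s≤s a<c)))

  normalCount-vanish : ∀ p {u w : Word n} → ¬ u ≼ w → normalCount p (wordVals u) (wordVals w) ≡ + 0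
  normalCount-vanish p {[]}            u⋠w   = ⊥-elim (u⋠w nil)
  normalCount-vanish p {c ∷ u} {[]}    _     = refl
  normalCount-vanish p {c ∷ u} {a ∷ w} cu⋠aw = begin
    normalCount p (wordVals (c ∷ u)) (wordVals (a ∷ w))
      ≡⟨ normalCount-∷-letter p (c ∷ u) (toℕ a) (wordVals w) ⟩
    skipWeight p b * normalCount (just b) (wordVals (c ∷ u)) (wordVals w)
      + headWeight (c ∷ u) b * normalCount (just b) (wordVals u) (wordVals w)
      ≡⟨ cong₂ _+_ (cong (skipWeight p b *_) (normalCount-vanish (just b) (cu⋠aw ∘ skip)))
                   (by-cases (c Fin.≤? a)) ⟩
    skipWeight p b * + 0 + + 0
      ≡⟨ trans (+-identityʳ _) (*-zeroʳ (skipWeight p b)) ⟩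
    + 0 ∎
    where
    open ≡-Reasoning
    b = letterVal a
    by-cases : Dec (c Fin.≤ a) → headWeight (c ∷ u) b * normalCount (just b) (wordVals u) (wordVals w) ≡ + 0
    by-cases (yes c≤a) = trans (cong (headWeight (c ∷ u) b *_) (normalCount-vanish (just b) (cu⋠aw ∘ keep c≤a)))
                               (*-zeroʳ (headWeight (c ∷ u) b))
    by-cases (no  c≰a) = cong (_* normalCount (just b) (wordVals u) (wordVals w))
                              (headWeight-vanish u (ℕ.≰⇒> c≰a))

  M≡normalSeries : ∀ u w → M u w ≡ normalSeries nothing u w
  M≡normalSeries u w =
    trans (cong (if ⌊ u ≼? w ⌋ then_else + 0)
                (sumℤ-filter (isNormal (wordVals u) (wordVals w)) (sign ∘ defect (wordVals w))
                             (candidates (wordVals w))))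
          (by-cases (u ≼? w))
    where
    by-cases : (u≼?w : Dec (u ≼ w)) →
               (if ⌊ u≼?w ⌋ then normalCount nothing (wordVals u) (wordVals w) else + 0) ≡ normalSeries nothing u w
    by-cases (yes _)   = normalCount≡normalSeries w nothing u
    by-cases (no u⋠w) = trans (sym (normalCount-vanish nothing u⋠w)) (normalCount≡normalSeries w nothing u)

  M-rational : ∀ u → IsRational (M u)
  M-rational u = ext (normalSeries-rational nothing u) (λ w → sym (M≡normalSeries u w))

-- The argument does not use 1 ≤ n.
mainTheorem2 : (n : ℕ) → 1 ≤ n → (u : Word n) → IsRational (Z u) × IsRational (M u)
mainTheorem2 _ _ u = Z-rational u , M-rational u
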